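{- For every term $M$, $\overline{\{\!|M|\!\}\,k}=M$ (here $\{\!|M|\!\}\,k$ is a computation combination of the form $TK$ with $T=\{\!|M|\!\}$ and $K=k$).
   Context: Syntax. Fix a ring of scalars; $\alpha$ ranges over it. Terms: $M,N ::= V \mid MN \mid \alpha.M \mid M+N$; values $V,W ::= B \mid 0 \mid \alpha.V \mid V+W$; base values $B ::= x \mid \lambda x.M$. Terms are taken up to $\alpha$-conversion; application associates left and binds tighter than $+$ and $\alpha.$. CPS translation. The variables $k,b$ are reserved names distinct from all variables of source terms. $\{\!|x|\!\}=x$; $\{\!|\lambda x.M|\!\}=\lambda k.k(\lambda x.\{\!|M|\!\})$; $\{\!|MN|\!\}=\lambda k.\{\!|M|\!\}(\lambda b.b\{\!|N|\!\}k)$; $\{\!|0|\!\}=0$; $\{\!|\alpha.M|\!\}=\lambda k.(\alpha.\{\!|M|\!\})k$; $\{\!|M+N|\!\}=\lambda k.(\{\!|M|\!\}+\{\!|N|\!\})k$. CPS grammar. Base computations $C ::= KB \mid BSK \mid TK$; computation combinations $D ::= C \mid 0 \mid \alpha.D \mid D_1+D_2$; base suspensions $S ::= x \mid \lambda k.C$; suspension combinations $T ::= S \mid 0 \mid \alpha.T \mid T_1+T_2$; continuations $K ::= k \mid \lambda b.bSK$; CPS-values $B ::= \lambda x.S$. Here $x$ ranges over ordinary variables, $k,b$ are reserved variables; $k$ occurs only as the continuation $k$ and as the binder in $\lambda k.C$; $b$ occurs only where displayed. Inverse translation: $\overline{KB}=\underline{K}[\phi(B)]$; $\overline{BSK}=\underline{K}[\phi(B)\sigma(S)]$;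 $\overline{TK}=\underline{K}[\sigma(T)]$; $\overline{0}=0$; $\overline{\alpha.D}=\alpha.\overline{D}$; $\overline{D_1+D_2}=\overline{D_1}+\overline{D_2}$; $\sigma(x)=x$; $\sigma(\lambda k.C)=\overline{C}$; $\sigma(0)=0$; $\sigma(\alpha.T)=\alpha.\sigma(T)$; $\sigma(T_1+T_2)=\sigma(T_1)+\sigma(T_2)$; $\phi(\lambda x.S)=\lambda x.\sigma(S)$; for a term $M$: $\underline{k}[M]=M$; $\underline{\lambda b.bSK}[M]=\underline{K}[M\,\sigma(S)]$. -}

module Defs where

open import Level using (Level)
open import Data.Nat using (ℕ)

-- The reserved variables k and b are
-- NOT variables of this kind: in the CPS syntax below they are built into the
-- constructors, so they are automatically distinct from all source variables.
Var : Set
Var = ℕ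

-- Source terms  M, N ::= x | λx.M | M N | 0 | α.M | M + N   over scalars A.
-- (Named variables; since the translation and its inverse preserve binder
--  names, the identity holds syntactically, hence a fortiori up to α.)
data Term {a : Level} (A : Set a) : Set a where
  var  : Var → Term A
  lam  : Var → Term A → Term A
  app  : Term A → Term A → Term A
  zero : Term A
  scal : A → Term A → Term A
  plus : Term A → Term A → Term A

-- CPS grammar (the "S" positions inside CPS-values
-- λx.S and continuations λb.b S K, and in B S K, are widened to T, since the
-- translation of 0 is 0, which is a T but not an S).
mutual
  data Comp {a : Level} (A : Set a) : Set a where
    KB : Cont A → CVal A → Comp A
    BTK : CVal A → SuspC A → Cont A → Comp A
    TK : SuspC A → Cont A → Comp A

  data Susp {a : Level} (A : Set a) : Set a where
    svar : Var → Susp A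
    lamk : Comp A → Susp A

  data SuspC {a : Level} (A : Set a) : Set a where
    susp  : Susp A → SuspC A
    tzero : SuspC A
    tscal : A → SuspC A → SuspC A
    tplus : SuspC A → SuspC A → SuspC A

  data Cont {a : Level} (A : Set a) : Set a where
    kvar : Cont A
    lamb : SuspC A → Cont A → Cont A

  data CVal {a : Level} (A : Set a) : Set a where
    lamx : Var → SuspC A → CVal A

data CompC {a : Level} (A : Set a) : Set a where
  comp  : Comp A → CompC A
  dzero : CompC A
  dscal : A → CompC A → CompC A
  dplus : CompC A → CompC A → CompC A

module _ {a : Level} {A : Set a} where

  cps : Term A → SuspC A
  cps (var x)    = susp (svar x)
  cps (lam x M)  = susp (lamk (KB kvar (lamx x (cps M))))
  cps (app M N)  = susp (lamk (TK (cps M) (lamb (cps N) kvar)))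
  cps zero       = tzero
  cps (scal α M) = susp (lamk (TK (tscal α (cps M)) kvar))
  cps (plus M N) = susp (lamk (TK (tplus (cps M) (cps N)) kvar))

  mutual
    barC : Comp A → Term A
    barC (KB K B)    = plugK K (φ B)
    barC (BTK B T K) = plugK K (app (φ B) (σ T))
    barC (TK T K)    = plugK K (σ T)

    σS : Susp A → Term A
    σS (svar x) = var x
    σS (lamk C) = barC C

    σ : SuspC A → Term A
    σ (susp S)      = σS S
    σ tzero         = zero
    σ (tscal α T)   = scal α (σ T)
    σ (tplus T₁ T₂) = plus (σ T₁) (σ T₂)

    φ : CVal A → Term A
    φ (lamx x T) = lam x (σ T)

    plugK : Cont A → Term A → Term A
    plugK kvar       M = M
    plugK (lamb S K) M = plugK K (app M (σ S))

  bar : CompC A → Term A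
  bar (comp C)      = barC C
  bar dzero         = zero
  bar (dscal α D)   = scal α (bar D)
  bar (dplus D₁ D₂) = plus (bar D₁) (bar D₂)

module Submission where

-- Unfolding the definitions, the computation {| M |} k is  TK {| M |} k,  and
-- its inverse translation is  k̲[σ({| M |})] = σ({| M |}),  since plugging into
-- the trivial continuation k does nothing.  So the theorem reduces to the
-- left-inverse property  σ ∘ {| - |} = id  on source terms, proved once by
-- structural induction on M (lemma σ-cps).

open import Defs
open import Algebra.Bundles using (Ring)
open import Relation.Binary.PropositionalEquality using (_≡_; refl; cong; cong₂)

σ-cps : ∀ {a} {A : Set a} (M : Term A) → σ (cps M) ≡ M
σ-cps (var x)    = refl
σ-cps (lam x M)  = cong (lam x) (σ-cps M)
σ-cps (app M N)  = cong₂ app (σ-cps M) (σ-cps N)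
σ-cps zero       = refl
σ-cps (scal α M) = cong (scal α) (σ-cps M)
σ-cps (plus M N) = cong₂ plus (σ-cps M) (σ-cps N)

-- Lemma 4.5:  the inverse translation of {| M |} k is M.  The left-hand side
-- reduces definitionally to σ({| M |}), because k̲[N] = N.
lemma4p5 : ∀ {c ℓ} (R : Ring c ℓ) (M : Term (Ring.Carrier R)) →
    bar (comp (TK (cps M) kvar)) ≡ M
lemma4p5 R M = σ-cps M
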